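{- If a multiplier $-\ltimes U:\mathcal W\to\mathcal V$ is cancellative and affine, then it is strongly affine, i.e. for every $W_0\in\mathcal W$ the functor $\mathrm{Fr}^{W_0}_U:\mathcal W/W_0\to\mathcal V/(W_0\ltimes U)$ is full.
   Context: $\mathcal W$ has a terminal object $\top$. A multiplier for $U\in\mathcal V$ is a functor $-\ltimes U:\mathcal W\to\mathcal V$ with an isomorphism $\top\ltimes U\cong U$; $\pi_2:W\ltimes U\to U$ is $(!_W\ltimes U)$ followed by it. $\mathrm{Fr}_U:\mathcal W\to\mathcal V/U$, $W\mapsto(W\ltimes U,\pi_2)$, $f\mapsto f\ltimes U$; cancellative means $\mathrm{Fr}_U$ faithful, affine means $\mathrm{Fr}_U$ full. $\mathrm{Fr}^{W_0}_U(W,\psi)=(W\ltimes U,\psi\ltimes U)$, $\mathrm{Fr}^{W_0}_U(f)=f\ltimes U$. -}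

module Defs where

open import Level using (Level; _⊔_) renaming (suc to lsuc)
open import Relation.Binary using (Rel; IsEquivalence)
open import Data.Product using (Σ; _,_)

record Category (o ℓ e : Level) : Set (lsuc (o ⊔ ℓ ⊔ e)) where
  infixr 9 _∘_
  infix  4 _≈_
  infixr 5 _⇒_
  field
    Obj       : Set o
    _⇒_       : Obj → Obj → Set ℓ
    _≈_       : ∀ {A B} → Rel (A ⇒ B) e
    id        : ∀ {A} → A ⇒ A
    _∘_       : ∀ {A B C} → B ⇒ C → A ⇒ B → A ⇒ C
    equiv     : ∀ {A B} → IsEquivalence (_≈_ {A} {B})
    identityˡ : ∀ {A B} {f : A ⇒ B} → id ∘ f ≈ f
    identityʳ : ∀ {A B} {f : A ⇒ B} → f ∘ id ≈ f
    assoc     : ∀ {A B C D} {f : A ⇒ B} {g : B ⇒ C} {h : C ⇒ D} →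
                (h ∘ g) ∘ f ≈ h ∘ (g ∘ f)
    ∘-resp-≈  : ∀ {A B C} {f h : B ⇒ C} {g i : A ⇒ B} →
                f ≈ h → g ≈ i → f ∘ g ≈ h ∘ i

  module Eq {A B : Obj} = IsEquivalence (equiv {A} {B})

record Functor {o ℓ e o′ ℓ′ e′ : Level}
               (C : Category o ℓ e) (D : Category o′ ℓ′ e′)
               : Set (o ⊔ ℓ ⊔ e ⊔ o′ ⊔ ℓ′ ⊔ e′) where
  private
    module C = Category C
    module D = Category D
  field
    F₀           : C.Obj → D.Obj
    F₁           : ∀ {A B} → A C.⇒ B → F₀ A D.⇒ F₀ B
    identity     : ∀ {A} → F₁ (C.id {A}) D.≈ D.id
    homomorphism : ∀ {A B X} {f : A C.⇒ B} {g : B C.⇒ X} →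
                   F₁ (g C.∘ f) D.≈ F₁ g D.∘ F₁ f
    F-resp-≈     : ∀ {A B} {f g : A C.⇒ B} → f C.≈ g → F₁ f D.≈ F₁ g

module _ {o ℓ e o′ ℓ′ e′ : Level}
         {C : Category o ℓ e} {D : Category o′ ℓ′ e′} where
  private
    module C = Category C
    module D = Category D

  Full : Functor C D → Set (o ⊔ ℓ ⊔ ℓ′ ⊔ e′)
  Full F = ∀ {A B} (g : F₀ A D.⇒ F₀ B) → Σ (A C.⇒ B) (λ f → F₁ f D.≈ g)
    where open Functor F

  Faithful : Functor C D → Set (o ⊔ ℓ ⊔ e ⊔ e′)
  Faithful F = ∀ {A B} (f g : A C.⇒ B) → F₁ f D.≈ F₁ g → f C.≈ g
    where open Functor F

record Terminal {o ℓ e : Level} (C : Category o ℓ e) : Set (o ⊔ ℓ ⊔ e) where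
  open Category C
  field
    ⊤        : Obj
    !        : ∀ {A} → A ⇒ ⊤
    !-unique : ∀ {A} (f : A ⇒ ⊤) → ! ≈ f

record Iso {o ℓ e : Level} (C : Category o ℓ e) (A B : Category.Obj C)
           : Set (ℓ ⊔ e) where
  open Category C
  field
    from : A ⇒ B
    to   : B ⇒ A
    isoˡ : to ∘ from ≈ id
    isoʳ : from ∘ to ≈ id

record SliceObj {o ℓ e : Level} (C : Category o ℓ e) (X : Category.Obj C)
                : Set (o ⊔ ℓ) where
  constructor sliceobj
  open Category C
  field
    {dom} : Obj
    arr   : dom ⇒ X

record SliceHom {o ℓ e : Level} (C : Category o ℓ e) (X : Category.Obj C)
                (A B : SliceObj C X) : Set (ℓ ⊔ e) where
  constructor slicehom
  open Category C
  open SliceObj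
  field
    {h}     : dom A ⇒ dom B
    commute : arr B ∘ h ≈ arr A

Slice : {o ℓ e : Level} (C : Category o ℓ e) (X : Category.Obj C) →
        Category (o ⊔ ℓ) (ℓ ⊔ e) e
Slice C X = record
  { Obj       = SliceObj C X
  ; _⇒_       = SliceHom C X
  ; _≈_       = λ f g → SliceHom.h f ≈ SliceHom.h g
  ; id        = slicehom identityʳ
  ; _∘_       = λ {A} {B} {Z} g f →
      slicehom {h = SliceHom.h g ∘ SliceHom.h f}
        (Eq.trans (Eq.sym assoc)
          (Eq.trans (∘-resp-≈ (SliceHom.commute g) Eq.refl)
                    (SliceHom.commute f)))
  ; equiv     = record { refl = Eq.refl ; sym = Eq.sym ; trans = Eq.trans }
  ; identityˡ = identityˡ
  ; identityʳ = identityʳ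
  ; assoc     = assoc
  ; ∘-resp-≈  = ∘-resp-≈
  }
  where open Category C

record Multiplier {o ℓ e o′ ℓ′ e′ : Level}
                  {W : Category o ℓ e} (T : Terminal W)
                  (V : Category o′ ℓ′ e′) (U : Category.Obj V)
                  : Set (o ⊔ ℓ ⊔ e ⊔ o′ ⊔ ℓ′ ⊔ e′) where
  field
    ⋉U      : Functor W V
    unitIso : Iso V (Functor.F₀ ⋉U (Terminal.⊤ T)) U

module _ {o ℓ e o′ ℓ′ e′ : Level}
         {W : Category o ℓ e} {T : Terminal W}
         {V : Category o′ ℓ′ e′} {U : Category.Obj V}
         (M : Multiplier T V U) where
  private
    module W = Category W
    module V = Category V
    open Terminal T
    open Multiplier M
    open Functor ⋉U
    open Iso unitIso

  π₂ : (X : W.Obj) → F₀ X V.⇒ U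
  π₂ X = from V.∘ F₁ (! {X})

  Fr : Functor W (Slice V U)
  Fr = record
    { F₀ = λ X → sliceobj (π₂ X)
    ; F₁ = λ {A} {B} f → slicehom {h = F₁ f}
        (V.Eq.trans V.assoc
          (V.∘-resp-≈ V.Eq.refl
            (V.Eq.trans (V.Eq.sym homomorphism)
              (F-resp-≈ (W.Eq.sym (!-unique (! W.∘ f)))))))
    ; identity     = identity
    ; homomorphism = homomorphism
    ; F-resp-≈     = F-resp-≈
    }

  FrOver : (W0 : W.Obj) → Functor (Slice W W0) (Slice V (F₀ W0))
  FrOver W0 = record
    { F₀ = λ A → sliceobj (F₁ (SliceObj.arr A))
    ; F₁ = λ f → slicehom {h = F₁ (SliceHom.h f)}
        (V.Eq.trans (V.Eq.sym homomorphism) (F-resp-≈ (SliceHom.commute f)))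
    ; identity     = identity
    ; homomorphism = homomorphism
    ; F-resp-≈     = F-resp-≈
    }

  Cancellative : Set _
  Cancellative = Faithful Fr

  Affine : Set _
  Affine = Full Fr

  StronglyAffine : Set _
  StronglyAffine = (W0 : W.Obj) → Full (FrOver W0)

module Submission where

-- An arrow g : (X ⋉ U, ψ ⋉ U) → (Y ⋉ U, φ ⋉ U) over W0 ⋉ U is in particular an
-- arrow over U, since π₂ factors through every φ ⋉ U. Affineness lifts it to
-- some f : X → Y with f ⋉ U ≈ g, and then (φ ∘ f) ⋉ U ≈ (φ ⋉ U) ∘ g ≈ ψ ⋉ U,
-- so cancellativity gives φ ∘ f ≈ ψ: f is an arrow of W / W0.

open import Level using (Level)
open import Data.Product using (_,_)
open import Relation.Binary.Bundles using (Setoid)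
import Relation.Binary.Reasoning.Setoid as SetoidReasoning
open import Defs

hom-setoid : {o ℓ e : Level} (C : Category o ℓ e) (A B : Category.Obj C) →
             Setoid ℓ e
hom-setoid C A B = record { isEquivalence = Category.equiv C {A} {B} }

module _ {o ℓ e o′ ℓ′ e′ : Level}
         {W : Category o ℓ e} {T : Terminal W}
         {V : Category o′ ℓ′ e′} {U : Category.Obj V}
         (M : Multiplier T V U) where
  private
    module W = Category W
    module V = Category V
    open Terminal T
    open Multiplier M
    open Functor ⋉U
    open Iso unitIso

  π₂-∘-⋉ : ∀ {Y Z} (φ : Y W.⇒ Z) → π₂ M Z V.∘ F₁ φ V.≈ π₂ M Y
  π₂-∘-⋉ {Y} φ = begin
    (from V.∘ F₁ !) V.∘ F₁ φ  ≈⟨ V.assoc ⟩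
    from V.∘ (F₁ ! V.∘ F₁ φ)  ≈⟨ V.∘-resp-≈ V.Eq.refl (V.Eq.sym homomorphism) ⟩
    from V.∘ F₁ (! W.∘ φ)     ≈⟨ V.∘-resp-≈ V.Eq.refl (F-resp-≈ (W.Eq.sym (!-unique _))) ⟩
    from V.∘ F₁ !             ∎
    where open SetoidReasoning (hom-setoid V (F₀ Y) U)

  FrOver-hom⇒Fr-hom : ∀ {W0} {A B : SliceObj W W0} →
    SliceHom V (F₀ W0) (Functor.F₀ (FrOver M W0) A) (Functor.F₀ (FrOver M W0) B) →
    SliceHom V U (Functor.F₀ (Fr M) (SliceObj.dom A)) (Functor.F₀ (Fr M) (SliceObj.dom B))
  FrOver-hom⇒Fr-hom {W0} {sliceobj {X} ψ} {sliceobj {Y} φ} (slicehom {g} g-over) =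
    slicehom {h = g} (begin
      π₂ M Y V.∘ g                         ≈⟨ V.∘-resp-≈ (V.Eq.sym (π₂-∘-⋉ φ)) V.Eq.refl ⟩
      (π₂ M W0 V.∘ F₁ φ) V.∘ g             ≈⟨ V.assoc ⟩
      π₂ M W0 V.∘ (F₁ φ V.∘ g)             ≈⟨ V.∘-resp-≈ V.Eq.refl g-over ⟩
      π₂ M W0 V.∘ F₁ ψ                     ≈⟨ π₂-∘-⋉ ψ ⟩
      π₂ M X                               ∎)
    where open SetoidReasoning (hom-setoid V (F₀ X) U)

mainTheorem10 : {o ℓ e o′ ℓ′ e′ : Level}
    {W : Category o ℓ e} (T : Terminal W)
    {V : Category o′ ℓ′ e′} {U : Category.Obj V}
    (M : Multiplier T V U) →
    Cancellative M → Affine M → StronglyAffine M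
mainTheorem10 {W = W} T {V = V} M canc aff W0 {sliceobj {X} ψ} {sliceobj φ} g
  with aff (FrOver-hom⇒Fr-hom M g)
... | f , f⋉U≈g = slicehom {h = f} (canc (φ W.∘ f) ψ φ∘f⋉U≈ψ⋉U) , f⋉U≈g
  where
    module W = Category W
    module V = Category V
    open Functor (Multiplier.⋉U M)
    open SetoidReasoning (hom-setoid V (F₀ X) (F₀ W0))
    φ∘f⋉U≈ψ⋉U : F₁ (φ W.∘ f) V.≈ F₁ ψ
    φ∘f⋉U≈ψ⋉U = begin
      F₁ (φ W.∘ f)                  ≈⟨ homomorphism ⟩
      F₁ φ V.∘ F₁ f                 ≈⟨ V.∘-resp-≈ V.Eq.refl f⋉U≈g ⟩
      F₁ φ V.∘ SliceHom.h g         ≈⟨ SliceHom.commute g ⟩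
      F₁ ψ                          ∎
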